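{- For every $n\ge1$, the support-level graph $\mathcal L_n^\sigma$ contains the path $1-2-\cdots-\rho(n)$ (i.e. $r$ and $r+1$ are adjacent for every $1\le r<\rho(n)$). In particular, $\mathcal L_n^\sigma$ is connected.
   Context: $G_n$ is the partition graph: its vertices are the partitions of $n$, and two distinct partitions $\lambda\neq\mu$ are adjacent when $\mu$ is obtained from $\lambda$ by moving one cell from one part (of size $x$, the part shrinking to $x-1$ and disappearing if $x=1$) to another part or to a new part of size $1$, followed by reordering the parts in weakly decreasing order. $\sigma(\lambda)$ is the number of distinct part sizes of $\lambda$, $T_r=r(r+1)/2$, and $\rho(n)=\max\{r:T_r\le n\}$. The support-level graph $\mathcal L_n^\sigma$ has vertex set $\{1,\dots,\rho(n)\}$, with $r$ and $s$ adjacent if there is an edge $\lambda\mu$ of $G_n$ with $\sigma(\lambda)=r$ and $\sigma(\mu)=s$. -}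

module Defs where

open import Data.Nat using (ℕ; zero; suc; _+_; _≤_; _<_; _≥_; _≤?_; _≟_; pred)
open import Data.List using (List; []; _∷_; length; filter; deduplicate; _++_; [_])
open import Data.Nat.ListAction using (sum)
open import Data.List.Relation.Unary.All using (All)
open import Data.List.Relation.Unary.Linked using (Linked)
open import Data.List.Relation.Binary.Permutation.Propositional using (_↭_)
open import Data.Product using (Σ; ∃; _×_; _,_)
open import Data.Sum using (_⊎_)
open import Relation.Nullary using (¬_; does)
open import Relation.Binary.PropositionalEquality using (_≡_; _≢_)
open import Relation.Binary.Construct.Closure.ReflexiveTransitive using (Star)
open import Data.Bool using (if_then_else_)

IsPartition : ℕ → List ℕ → Set
IsPartition n λs = Linked _≥_ λs × All (1 ≤_) λs × sum λs ≡ n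

decAt : ℕ → List ℕ → List ℕ
decAt _       []       = []
decAt zero    (x ∷ xs) = pred x ∷ xs
decAt (suc i) (x ∷ xs) = x ∷ decAt i xs

incAt : ℕ → List ℕ → List ℕ
incAt _       []       = []
incAt zero    (x ∷ xs) = suc x ∷ xs
incAt (suc i) (x ∷ xs) = x ∷ incAt i xs

dropZeros : List ℕ → List ℕ
dropZeros = filter (1 ≤?_)

-- ν is an (unsorted) result of moving one cell of λ from part i
-- either to another part j ≠ i, or to a new part of size 1.
RawMove : List ℕ → List ℕ → Set
RawMove λs ν =
  Σ ℕ λ i → i < length λs ×
    ( (Σ ℕ λ j → j < length λs × i ≢ j × ν ≡ dropZeros (incAt j (decAt i λs)))
    ⊎ ν ≡ dropZeros (decAt i λs ++ [ 1 ]) )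

-- adjacency in the partition graph G_n (μ is the reordering of a raw move result)
Adj : ℕ → List ℕ → List ℕ → Set
Adj n λs μ = IsPartition n λs × IsPartition n μ × λs ≢ μ ×
  Σ (List ℕ) λ ν → RawMove λs ν × μ ↭ ν

σ : List ℕ → ℕ
σ λs = length (deduplicate _≟_ λs)

Tri : ℕ → ℕ
Tri zero    = 0
Tri (suc r) = suc r + Tri r

-- ρ(n) = max { r : T_r ≤ n }; the search over r ≤ n suffices since T_r ≥ r.
ρ-search : ℕ → ℕ → ℕ
ρ-search n zero    = zero
ρ-search n (suc r) = if does (Tri (suc r) ≤? n) then suc r else ρ-search n r

ρ : ℕ → ℕ
ρ n = ρ-search n n

LevelAdj : ℕ → ℕ → ℕ → Set
LevelAdj n r s = Σ (List ℕ) λ λs → Σ (List ℕ) λ μ →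
  Adj n λs μ × σ λs ≡ r × σ μ ≡ s

LevelConnected : ℕ → Set
LevelConnected n = ∀ r s → 1 ≤ r → r ≤ ρ n → 1 ≤ s → s ≤ ρ n →
  Star (λ a b → LevelAdj n a b ⊎ LevelAdj n b a) r s

{-# OPTIONS --safe #-}
module Submission where

-- For r = k + 1 with T_(k+2) ≤ n put a = n − T_(k+1) ≥ k + 2. Splitting one cell off the
-- largest part of (a+1, k+1, k, …, 2) into a new part of size 1 gives (a, k+1, k, …, 1),
-- and these partitions of n have k + 1 and k + 2 distinct part sizes respectively.
-- Edges between consecutive levels then connect every pair of levels.

open import Defs
open import Data.Nat using (ℕ; zero; suc; _+_; _∸_; _≤_; _<_; _>_; _≤′_; ≤′-reflexive; ≤′-step; _≟_; _≤?_; z≤n; s≤s)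
open import Data.Nat.Properties
open import Data.Nat.ListAction using (sum)
open import Data.Nat.ListAction.Properties using (sum-++)
open import Data.List using (List; []; _∷_; length; filter; deduplicate; _++_; [_])
open import Data.List.Properties using (filter-all; ∷-injectiveˡ)
open import Data.List.Relation.Unary.All using (All; []; _∷_)
import Data.List.Relation.Unary.All as All
open import Data.List.Relation.Unary.All.Properties using (++⁺)
open import Data.List.Relation.Unary.Linked using (Linked; []; [-]; _∷_)
import Data.List.Relation.Unary.Linked as Linked
open import Data.List.Relation.Unary.Linked.Properties using (Linked⇒All)
open import Data.List.Relation.Binary.Permutation.Propositional using (↭-refl)
open import Data.Bool using (if_then_else_)
open import Data.Product using (_×_; _,_)
open import Data.Sum using (_⊎_; inj₁; inj₂; swap)
open import Function using (_∘_)
open import Relation.Nullary using (Dec; does; ¬?; yes; no)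
open import Relation.Binary.PropositionalEquality
  using (_≡_; _≢_; refl; sym; trans; cong; cong₂; subst; module ≡-Reasoning)
open import Relation.Binary.Construct.Closure.ReflexiveTransitive
  using (Star; ε; _◅_; _◅◅_) renaming (map to mapStar; reverse to reverseStar)

deduplicate-strictlyDecreasing : ∀ {xs} → Linked _>_ xs → deduplicate _≟_ xs ≡ xs
deduplicate-strictlyDecreasing []  = refl
deduplicate-strictlyDecreasing [-] = refl
deduplicate-strictlyDecreasing {x ∷ xs} (x>y ∷ ys↘) = cong (x ∷_) (begin
  filter x≢? (deduplicate _≟_ xs) ≡⟨ cong (filter x≢?) (deduplicate-strictlyDecreasing ys↘) ⟩
  filter x≢? xs                   ≡⟨ filter-all x≢? (All.map (λ y<x x≡y → <-irrefl (sym x≡y) y<x) xs<x) ⟩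
  xs                              ∎)
  where
  open ≡-Reasoning
  x≢? : ∀ y → Dec (x ≢ y)
  x≢? = ¬? ∘ (x ≟_)
  xs<x : All (_< x) xs
  xs<x = Linked⇒All (λ a>b b>c → <-trans b>c a>b) x>y ys↘

σ-strictlyDecreasing : ∀ {xs} → Linked _>_ xs → σ xs ≡ length xs
σ-strictlyDecreasing = cong length ∘ deduplicate-strictlyDecreasing

staircase : ℕ → ℕ → List ℕ
staircase b zero    = []
staircase b (suc k) = suc (b + k) ∷ staircase b k

length-staircase : ∀ b k → length (staircase b k) ≡ k
length-staircase b zero    = refl
length-staircase b (suc k) = cong suc (length-staircase b k)

staircase-positive : ∀ b k → All (1 ≤_) (staircase b k)
staircase-positive b zero    = []
staircase-positive b (suc k) = s≤s z≤n ∷ staircase-positive b k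

staircase-strictlyDecreasing : ∀ b k {x} → b + k < x → Linked _>_ (x ∷ staircase b k)
staircase-strictlyDecreasing b zero    _   = [-]
staircase-strictlyDecreasing b (suc k) {x} b+k<x =
  subst (_< x) (+-suc b k) b+k<x ∷ staircase-strictlyDecreasing b k ≤-refl

staircase-∷ʳ : ∀ b k → staircase (suc b) k ++ [ suc b ] ≡ staircase b (suc k)
staircase-∷ʳ b zero    = cong (λ c → suc c ∷ []) (sym (+-identityʳ b))
staircase-∷ʳ b (suc k) = cong₂ _∷_ (cong suc (sym (+-suc b k))) (staircase-∷ʳ b k)

sum-staircase : ∀ k → sum (staircase 0 k) ≡ Tri k
sum-staircase zero    = refl
sum-staircase (suc k) = cong (suc k +_) (sum-staircase k)

rawMove-splitHead : ∀ {x xs} → 1 ≤ x → All (1 ≤_) xs → RawMove (suc x ∷ xs) (x ∷ xs ++ [ 1 ])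
rawMove-splitHead 1≤x xs⁺ =
  0 , s≤s z≤n , inj₂ (sym (filter-all (1 ≤?_) (1≤x ∷ ++⁺ xs⁺ (s≤s z≤n ∷ []))))

sum-splitHead : ∀ x xs → sum (suc x ∷ xs) ≡ sum (x ∷ xs ++ [ 1 ])
sum-splitHead x xs = begin
  suc x + sum xs          ≡⟨ sym (+-suc x (sum xs)) ⟩
  x + suc (sum xs)        ≡⟨ cong (x +_) (+-comm 1 (sum xs)) ⟩
  x + (sum xs + 1)        ≡⟨ cong (x +_) (sym (sum-++ xs [ 1 ])) ⟩
  x + sum (xs ++ [ 1 ])   ∎
  where open ≡-Reasoning

levelAdj-staircase : ∀ a k → suc k < a → LevelAdj (a + Tri (suc k)) (suc k) (suc (suc k))
levelAdj-staircase a k k+1<a =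
  λs , μ , (λs-partition , μ-partition , heads-differ , μ , move , ↭-refl) , σ-λs , σ-μ
  where
  λs μ : List ℕ
  λs = suc a ∷ staircase 1 k
  μ  = a ∷ staircase 0 (suc k)

  split : a ∷ staircase 1 k ++ [ 1 ] ≡ μ
  split = cong (a ∷_) (staircase-∷ʳ 0 k)

  1≤a : 1 ≤ a
  1≤a = ≤-trans (s≤s z≤n) k+1<a

  λs↘ : Linked _>_ λs
  λs↘ = staircase-strictlyDecreasing 1 k (s≤s (<⇒≤ k+1<a))

  μ↘ : Linked _>_ μ
  μ↘ = staircase-strictlyDecreasing 0 (suc k) k+1<a

  sum-μ : sum μ ≡ a + Tri (suc k)
  sum-μ = cong (a +_) (sum-staircase (suc k))

  λs-partition : IsPartition (a + Tri (suc k)) λs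
  λs-partition = Linked.map <⇒≤ λs↘ , s≤s z≤n ∷ staircase-positive 1 k ,
    trans (sum-splitHead a (staircase 1 k)) (trans (cong sum split) sum-μ)

  μ-partition : IsPartition (a + Tri (suc k)) μ
  μ-partition = Linked.map <⇒≤ μ↘ , 1≤a ∷ staircase-positive 0 (suc k) , sum-μ

  heads-differ : λs ≢ μ
  heads-differ = 1+n≢n ∘ ∷-injectiveˡ

  move : RawMove λs μ
  move = subst (RawMove λs) split (rawMove-splitHead 1≤a (staircase-positive 1 k))

  σ-λs : σ λs ≡ suc k
  σ-λs = trans (σ-strictlyDecreasing λs↘) (cong suc (length-staircase 1 k))

  σ-μ : σ μ ≡ suc (suc k)
  σ-μ = trans (σ-strictlyDecreasing μ↘) (cong suc (length-staircase 0 (suc k)))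

levelAdj-suc : ∀ n k → Tri (suc (suc k)) ≤ n → LevelAdj n (suc k) (suc (suc k))
levelAdj-suc n k T≤n = subst (λ m → LevelAdj m (suc k) (suc (suc k))) a+T≡n
  (levelAdj-staircase (n ∸ Tri (suc k)) k (m+n≤o⇒m≤o∸n (suc (suc k)) T≤n))
  where
  a+T≡n : n ∸ Tri (suc k) + Tri (suc k) ≡ n
  a+T≡n = m∸n+n≡m (≤-trans (m≤n+m (Tri (suc k)) (suc (suc k))) T≤n)

Tri-mono-≤ : ∀ {r s} → r ≤ s → Tri r ≤ Tri s
Tri-mono-≤ {zero}  _         = z≤n
Tri-mono-≤ {suc r} (s≤s r≤s) = +-mono-≤ (s≤s r≤s) (Tri-mono-≤ r≤s)

Tri[ρ-search]≤n : ∀ n r → Tri (ρ-search n r) ≤ n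
Tri[ρ-search]≤n n zero    = z≤n
Tri[ρ-search]≤n n (suc r) = pick (Tri (suc r) ≤? n)
  where
  pick : (d : Dec (Tri (suc r) ≤ n)) → Tri (if does d then suc r else ρ-search n r) ≤ n
  pick (yes T≤n) = T≤n
  pick (no _)    = Tri[ρ-search]≤n n r

levelAdj-below-ρ : ∀ n r → 1 ≤ r → r < ρ n → LevelAdj n r (suc r)
levelAdj-below-ρ n (suc k) _ r<ρ =
  levelAdj-suc n k (≤-trans (Tri-mono-≤ r<ρ) (Tri[ρ-search]≤n n n))

module _ {R : ℕ → ℕ → Set} {lo hi : ℕ} (step : ∀ r → lo ≤ r → r < hi → R r (suc r)) where

  star-ascending : ∀ {r s} → lo ≤ r → s ≤ hi → r ≤′ s → Star R r s
  star-ascending _    _      (≤′-reflexive refl) = ε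
  star-ascending lo≤r 1+t≤hi (≤′-step {t} r≤′t) =
    star-ascending lo≤r (≤-trans (n≤1+n t) 1+t≤hi) r≤′t
      ◅◅ step t (≤-trans lo≤r (≤′⇒≤ r≤′t)) 1+t≤hi ◅ ε

  symStar-interval : ∀ {r s} → lo ≤ r → r ≤ hi → lo ≤ s → s ≤ hi →
    Star (λ a b → R a b ⊎ R b a) r s
  symStar-interval {r} {s} lo≤r r≤hi lo≤s s≤hi with ≤-total r s
  ... | inj₁ r≤s = mapStar inj₁ (star-ascending lo≤r s≤hi (≤⇒≤′ r≤s))
  ... | inj₂ s≤r = reverseStar swap (mapStar inj₁ (star-ascending lo≤s r≤hi (≤⇒≤′ s≤r)))

corollary6p6 : (n : ℕ) → 1 ≤ n →
    ((r : ℕ) → 1 ≤ r → r < ρ n → LevelAdj n r (suc r)) × LevelConnected n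
corollary6p6 n _ = levelAdj-below-ρ n , λ _ _ → symStar-interval (levelAdj-below-ρ n)
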